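{- Let $k,N$ be positive integers, and let $d\ne d'$ and $e\ne e'$ be integers with \[ d,d',e,e'\in\left(\frac N3-\frac{N}{48k+15},\ \frac N3+\frac{N}{48k+15}\right). \] Let $\alpha,\alpha'\in[1,8k+2]$ be integers. Then $\alpha d\ne\alpha' d'$ and $\alpha e\ne\alpha' e'$. Moreover, if $\alpha<\alpha'$, then $\alpha d<\alpha' d'$ and $\alpha e<\alpha' e'$.
   Context: $[a,b]$ denotes the set of integers $\{a,a+1,\dots,b\}$. -}

module Defs where

open import Data.Nat using (ℕ; _+_; _*_)
open import Data.Integer using (ℤ; +_)
open import Data.Rational using (ℚ; _/_; _-_; _<_) renaming (_+_ to _+ℚ_)
open import Data.Product using (_×_)

-- The open interval ( N/3 - N/(48k+15) , N/3 + N/(48k+15) ) in ℚ,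
-- and membership of an integer x in it (x viewed as the rational x/1).
-- 15 + 48 * k reduces to a successor, so the NonZero instance is found.
InInterval : (k N : ℕ) → ℤ → Set
InInterval k N x =
  ((+ N / 3) - (+ N / (15 + 48 * k)) < (x / 1))
  × ((x / 1) < (+ N / 3) +ℚ (+ N / (15 + 48 * k)))

-- With c = 48k + 12, clearing the denominator 3 (3 + c) = 3 (48k + 15) turns
-- x ∈ (N/3 − N/(3 + c), N/3 + N/(3 + c)) into N c < 3 (3 + c) x < N (6 + c).  For α < α' ≤ 8k + 2 we have 6α ≤ c, hence
-- α (6 + c) ≤ (α + 1) c ≤ α' c, so α x · 3(3 + c) < α N (6 + c) ≤ α' N c < α' x' · 3(3 + c).
-- Inequality of α d and α' d' then follows by trichotomy on α, α', cancelling α when α = α'.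
module Submission where

open import Defs
open import Data.Nat using (ℕ; _+_; _*_; _≤_) renaming (_<_ to _<ℕ_)
open import Data.Integer using (ℤ; +_) renaming (_*_ to _*ℤ_; _<_ to _<ℤ_)
open import Data.Product using (_×_)
open import Relation.Binary.PropositionalEquality using (_≢_)

open import Data.Product using (_,_)
open import Data.Nat using (suc)
import Data.Nat.Properties as ℕ
import Data.Integer as ℤ
import Data.Integer.Properties as ℤ
open import Data.Integer.Tactic.RingSolver using (solve-∀)
import Data.Nat.Tactic.RingSolver as NS
open import Data.Rational using (ℚ; _/_; _-_; -_; toℚᵘ) renaming (_+_ to _+ℚ_; _<_ to _<ℚ_)
import Data.Rational.Properties as ℚ
open import Data.Rational.Unnormalised as ℚᵘ using (ℚᵘ; mkℚᵘ; ↥_; ↧_; _≃_)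
import Data.Rational.Unnormalised.Properties as ℚᵘ
open import Relation.Binary.PropositionalEquality using (_≡_; refl; sym; cong; subst)
open import Relation.Binary.Definitions using (Tri; tri<; tri≈; tri>)

<-/1⇒*<* : ∀ {r : ℚ} {p : ℚᵘ} (x : ℤ) → toℚᵘ r ≃ p → r <ℚ x / 1 → ↥ p *ℤ + 1 <ℤ x *ℤ ↧ p
<-/1⇒*<* x r≃p r<x = ℚᵘ.drop-*<*
  (ℚᵘ.<-respˡ-≃ r≃p (ℚᵘ.<-respʳ-≃ (ℚ.toℚᵘ-fromℚᵘ (mkℚᵘ x 0)) (ℚ.toℚᵘ-mono-< r<x)))

/1-<⇒*<* : ∀ {r : ℚ} {p : ℚᵘ} (x : ℤ) → toℚᵘ r ≃ p → x / 1 <ℚ r → x *ℤ ↧ p <ℤ ↥ p *ℤ + 1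
/1-<⇒*<* x r≃p x<r = ℚᵘ.drop-*<*
  (ℚᵘ.<-respʳ-≃ r≃p (ℚᵘ.<-respˡ-≃ (ℚ.toℚᵘ-fromℚᵘ (mkℚᵘ x 0)) (ℚ.toℚᵘ-mono-< x<r)))

-- Here a / suc n is definitionally fromℚᵘ (mkℚᵘ a n), so toℚᵘ-fromℚᵘ applies.
module _ (N c : ℕ) where

  toℚᵘ-third-minus : toℚᵘ (+ N / 3 - + N / (3 + c)) ≃ mkℚᵘ (+ N) 2 ℚᵘ.- mkℚᵘ (+ N) (2 + c)
  toℚᵘ-third-minus = ℚᵘ.≃-trans (ℚ.toℚᵘ-homo-+ (+ N / 3) (- (+ N / (3 + c))))
    (ℚᵘ.+-cong (ℚ.toℚᵘ-fromℚᵘ (mkℚᵘ (+ N) 2))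
      (ℚᵘ.≃-trans (ℚ.toℚᵘ-homo‿- (+ N / (3 + c))) (ℚᵘ.-‿cong (ℚ.toℚᵘ-fromℚᵘ (mkℚᵘ (+ N) (2 + c))))))

  toℚᵘ-third-plus : toℚᵘ (+ N / 3 +ℚ + N / (3 + c)) ≃ mkℚᵘ (+ N) 2 ℚᵘ.+ mkℚᵘ (+ N) (2 + c)
  toℚᵘ-third-plus = ℚᵘ.≃-trans (ℚ.toℚᵘ-homo-+ (+ N / 3) (+ N / (3 + c)))
    (ℚᵘ.+-cong (ℚ.toℚᵘ-fromℚᵘ (mkℚᵘ (+ N) 2)) (ℚ.toℚᵘ-fromℚᵘ (mkℚᵘ (+ N) (2 + c))))

  third-minus-<⇒ : ∀ x → + N / 3 - + N / (3 + c) <ℚ x / 1 → + N *ℤ + c <ℤ x *ℤ + (3 * (3 + c))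
  third-minus-<⇒ x h =
    subst (_<ℤ x *ℤ + (3 * (3 + c))) (numerator (+ N) (+ c)) (<-/1⇒*<* x toℚᵘ-third-minus h)
    where
    numerator : ∀ n m → (n *ℤ (+ 3 ℤ.+ m) ℤ.+ ℤ.- n *ℤ + 3) *ℤ + 1 ≡ n *ℤ m
    numerator = solve-∀

  <-third-plus⇒ : ∀ x → x / 1 <ℚ + N / 3 +ℚ + N / (3 + c) → x *ℤ + (3 * (3 + c)) <ℤ + N *ℤ + (6 + c)
  <-third-plus⇒ x h =
    subst (x *ℤ + (3 * (3 + c)) <ℤ_) (numerator (+ N) (+ c)) (/1-<⇒*<* x toℚᵘ-third-plus h)
    where
    numerator : ∀ n m → (n *ℤ (+ 3 ℤ.+ m) ℤ.+ n *ℤ + 3) *ℤ + 1 ≡ n *ℤ (+ 6 ℤ.+ m)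
    numerator = solve-∀

*-+-≤-* : ∀ {a a' w c} → a <ℕ a' → a * w ≤ c → a * (w + c) ≤ a' * c
*-+-≤-* {a} {a'} {w} {c} a<a' aw≤c = begin
  a * (w + c)   ≡⟨ ℕ.*-distribˡ-+ a w c ⟩
  a * w + a * c ≤⟨ ℕ.+-monoˡ-≤ (a * c) aw≤c ⟩
  suc a * c     ≤⟨ ℕ.*-monoˡ-≤ c a<a' ⟩
  a' * c        ∎
  where open ℕ.≤-Reasoning

*-<-*-between : ∀ {M ℓ u x x' : ℤ} {a a' : ℕ} .{{_ : ℤ.NonNegative M}} → a <ℕ a' →
  x *ℤ M <ℤ u → ℓ <ℤ x' *ℤ M → + a *ℤ u ℤ.≤ + a' *ℤ ℓ → + a *ℤ x <ℤ + a' *ℤ x'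
*-<-*-between {M} {ℓ} {u} {x} {x'} {a} {suc a'} _ xM<u ℓ<x'M au≤a'ℓ = ℤ.*-cancelʳ-<-nonNeg M (begin-strict
  + a *ℤ x *ℤ M        ≡⟨ ℤ.*-assoc (+ a) x M ⟩
  + a *ℤ (x *ℤ M)      ≤⟨ ℤ.*-monoˡ-≤-nonNeg (+ a) (ℤ.<⇒≤ xM<u) ⟩
  + a *ℤ u             ≤⟨ au≤a'ℓ ⟩
  + suc a' *ℤ ℓ        <⟨ ℤ.*-monoˡ-<-pos (+ suc a') ℓ<x'M ⟩
  + suc a' *ℤ (x' *ℤ M) ≡⟨ ℤ.*-assoc (+ suc a') x' M ⟨
  + suc a' *ℤ x' *ℤ M  ∎)
  where open ℤ.≤-Reasoning

pos-*-mono-≤ : ∀ {a a' m n} (N : ℕ) → a * m ≤ a' * n → + a *ℤ (+ N *ℤ + m) ℤ.≤ + a' *ℤ (+ N *ℤ + n)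
pos-*-mono-≤ {a} {a'} {m} {n} N am≤a'n = begin
  + a *ℤ (+ N *ℤ + m)   ≡⟨ left-comm (+ a) (+ N) (+ m) ⟩
  + N *ℤ (+ a *ℤ + m)   ≡⟨ cong (+ N *ℤ_) (ℤ.pos-* a m) ⟨
  + N *ℤ + (a * m)      ≤⟨ ℤ.*-monoˡ-≤-nonNeg (+ N) (ℤ.+≤+ am≤a'n) ⟩
  + N *ℤ + (a' * n)     ≡⟨ cong (+ N *ℤ_) (ℤ.pos-* a' n) ⟩
  + N *ℤ (+ a' *ℤ + n)  ≡⟨ left-comm (+ N) (+ a') (+ n) ⟩
  + a' *ℤ (+ N *ℤ + n)  ∎
  where
  open ℤ.≤-Reasoning
  left-comm : ∀ i j k → i *ℤ (j *ℤ k) ≡ j *ℤ (i *ℤ k)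
  left-comm = solve-∀

InInterval-*-< : ∀ k N {x x'} → InInterval k N x → InInterval k N x' →
  {a a' : ℕ} → a <ℕ a' → a' ≤ 8 * k + 2 → + a *ℤ x <ℤ + a' *ℤ x'
InInterval-*-< k N {x} {x'} (_ , x<) (x'> , _) {a} {a'} a<a' a'≤ =
  *-<-*-between a<a' (<-third-plus⇒ N c x x<) (third-minus-<⇒ N c x' x'>)
    (pos-*-mono-≤ {a} {a'} {6 + c} {c} N (*-+-≤-* a<a' 6a≤c))
  where
  -- The denominator 15 + 48 * k of InInterval is 3 + c definitionally.
  c : ℕ
  c = 12 + 48 * k
  6a≤c : a * 6 ≤ c
  6a≤c = ℕ.≤-trans (ℕ.*-monoˡ-≤ 6 (ℕ.≤-trans (ℕ.<⇒≤ a<a') a'≤)) (ℕ.≤-reflexive (six-times k))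
    where
    six-times : ∀ k → (8 * k + 2) * 6 ≡ 12 + 48 * k
    six-times = NS.solve-∀

InInterval-*-≢ : ∀ k N {x x'} → x ≢ x' → InInterval k N x → InInterval k N x' →
  {a a' : ℕ} → 1 ≤ a → a ≤ 8 * k + 2 → a' ≤ 8 * k + 2 → + a *ℤ x ≢ + a' *ℤ x'
InInterval-*-≢ k N {x} {x'} x≢x' hx hx' {a} {a'} 1≤a a≤ a'≤ = by-cases (ℕ.<-cmp a a')
  where
  by-cases : Tri (a <ℕ a') (a ≡ a') (a' <ℕ a) → + a *ℤ x ≢ + a' *ℤ x'
  by-cases (tri< a<a' _ _) = ℤ.<⇒≢ (InInterval-*-< k N hx hx' a<a' a'≤)
  by-cases (tri> _ _ a'<a) = λ ax≡a'x' → ℤ.<⇒≢ (InInterval-*-< k N hx' hx a'<a a≤) (sym ax≡a'x')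
  by-cases (tri≈ _ refl _) = λ ax≡ax' → x≢x' (cancel 1≤a ax≡ax')
    where
    cancel : ∀ {b} → 1 ≤ b → + b *ℤ x ≡ + b *ℤ x' → x ≡ x'
    cancel {suc b} _ = ℤ.*-cancelˡ-≡ (+ suc b) x x'

lemma15 : (k N : ℕ) → 1 ≤ k → 1 ≤ N →
    (d d' e e' : ℤ) → d ≢ d' → e ≢ e' →
    InInterval k N d → InInterval k N d' → InInterval k N e → InInterval k N e' →
    (α α' : ℕ) → 1 ≤ α → α ≤ 8 * k + 2 → 1 ≤ α' → α' ≤ 8 * k + 2 →
    ((+ α) *ℤ d ≢ (+ α') *ℤ d')
    × ((+ α) *ℤ e ≢ (+ α') *ℤ e')
    × (α <ℕ α' → ((+ α) *ℤ d <ℤ (+ α') *ℤ d') × ((+ α) *ℤ e <ℤ (+ α') *ℤ e'))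
lemma15 k N _ _ d d' e e' d≢d' e≢e' hd hd' he he' α α' 1≤α α≤ _ α'≤ =
  InInterval-*-≢ k N d≢d' hd hd' 1≤α α≤ α'≤ ,
  InInterval-*-≢ k N e≢e' he he' 1≤α α≤ α'≤ ,
  λ α<α' → InInterval-*-< k N hd hd' α<α' α'≤ , InInterval-*-< k N he he' α<α' α'≤
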